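{- If a graph $H$ has at least $2$ edges and $v$ is detectable in $H$, then $H-v$ has at least one edge.
   Context: Graphs are finite and simple. For a graph $G$, $M(G)$ is the induced subgraph of $G$ on its non-isolated vertices; $G-v$ is $G$ with vertex $v$ deleted. A non-isolated vertex $v$ of $H$ is obscure in $H$ if there exist distinct non-isolated vertices $v_1,v_2$ of $H$ with $\deg_{H-v_1}(v_2)>0$ and an induced subgraph $H'$ of $H-v_1-v_2$ with $M(H-v)\cong H'$. A vertex is detectable in $H$ if it is non-isolated and not obscure in $H$. -}

module Defs where

open import Data.Nat using (ℕ)
open import Data.Fin using (Fin)
open import Data.Bool using (Bool; true; false)
open import Data.Unit using (⊤)
open import Data.Empty using (⊥)
open import Data.Product using (Σ; ∃; ∃-syntax; _×_; _,_)
open import Data.Sum using (_⊎_)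
open import Relation.Nullary using (¬_)
open import Relation.Binary.PropositionalEquality using (_≡_; _≢_)

record Graph (n : ℕ) : Set where
  field
    adj    : Fin n → Fin n → Bool
    sym    : ∀ x y → adj x y ≡ adj y x
    irrefl : ∀ x → adj x x ≡ false
open Graph public

Adj : ∀ {n} → Graph n → Fin n → Fin n → Set
Adj G x y = adj G x y ≡ true

-- Every graph occurring in the statement (H, H - v, M(H - v), H - v1 - v2,
-- and induced subgraphs of these) is an induced subgraph of H, so it is
-- represented by its vertex set, a predicate on the vertices of H.
VSet : ℕ → Set₁
VSet n = Fin n → Set

All : ∀ {n} → VSet n
All _ = ⊤

Del : ∀ {n} → VSet n → Fin n → VSet n
Del S v u = S u × u ≢ v

_⊆ᵥ_ : ∀ {n} → VSet n → VSet n → Set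
A ⊆ᵥ B = ∀ x → A x → B x

NonIsolatedIn : ∀ {n} → Graph n → VSet n → Fin n → Set
NonIsolatedIn G S v = S v × ∃[ u ] (S u × Adj G v u)

M : ∀ {n} → Graph n → VSet n → VSet n
M G S = NonIsolatedIn G S

Iso : ∀ {n} → Graph n → VSet n → VSet n → Set
Iso {n} G A B =
  Σ (Fin n → Fin n) λ f → Σ (Fin n → Fin n) λ g →
    (∀ x → A x → B (f x)) ×
    (∀ y → B y → A (g y)) ×
    (∀ x → A x → g (f x) ≡ x) ×
    (∀ y → B y → f (g y) ≡ y) ×
    (∀ x y → A x → A y → adj G x y ≡ adj G (f x) (f y))

Obscure : ∀ {n} → Graph n → Fin n → Set₁
Obscure G v =
  NonIsolatedIn G All v ×
  Σ _ λ v₁ → Σ _ λ v₂ →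
    v₁ ≢ v₂ × NonIsolatedIn G All v₁ × NonIsolatedIn G All v₂ ×
    NonIsolatedIn G (Del All v₁) v₂ ×
    Σ (VSet _) λ H' → (H' ⊆ᵥ Del (Del All v₁) v₂) ×
      Iso G (M G (Del All v)) H'

Detectable : ∀ {n} → Graph n → Fin n → Set₁
Detectable G v = NonIsolatedIn G All v × ¬ Obscure G v

HasEdge : ∀ {n} → Graph n → VSet n → Set
HasEdge G S = ∃[ a ] ∃[ b ] (S a × S b × Adj G a b)

AtLeastTwoEdges : ∀ {n} → Graph n → Set
AtLeastTwoEdges G =
  ∃[ a ] ∃[ b ] ∃[ c ] ∃[ d ]
    (Adj G a b × Adj G c d ×
     ¬ ((a ≡ c × b ≡ d) ⊎ (a ≡ d × b ≡ c)))

{-# OPTIONS --safe #-}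
module Submission where

-- If H − v had no edge, every edge of H would contain v, so the two edges of H
-- would give v two distinct neighbours x and y. Then M(H − v) is empty, hence
-- isomorphic to the empty induced subgraph of H − x − y, while y is still
-- adjacent to v in H − x: so v is obscure (take v₁ = x, v₂ = y).
-- Having an edge is decidable for a finite graph, so refuting edgelessness of
-- H − v produces an actual edge.

open import Defs
open import Data.Nat using (ℕ)
open import Data.Fin using (Fin; _≟_)
open import Data.Fin.Properties using (any?)
open import Data.Bool using (true)
import Data.Bool.Properties as Bool
open import Data.Unit using (tt)
open import Data.Empty using (⊥-elim)
open import Data.Product using (∃-syntax; _×_; _,_)
open import Data.Sum using (_⊎_; inj₁; inj₂)
open import Function using (id)
open import Relation.Nullary using (¬_; Dec; yes; no; ¬?; _×-dec_)
open import Relation.Unary using (Decidable; ∅)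
open import Relation.Unary.Properties using (U?; _∩?_)
open import Relation.Binary.PropositionalEquality using (_≡_; _≢_; refl; trans)
import Relation.Binary.PropositionalEquality as ≡

private
  variable
    n : ℕ

Del? : {S : VSet n} → Decidable S → ∀ v → Decidable (Del S v)
Del? S? v = S? ∩? λ u → ¬? (u ≟ v)

HasEdge? : (G : Graph n) {S : VSet n} → Decidable S → Dec (HasEdge G S)
HasEdge? G S? =
  any? λ a → any? λ b → S? a ×-dec S? b ×-dec adj G a b Bool.≟ true

Adj-sym : (G : Graph n) {a b : Fin n} → Adj G a b → Adj G b a
Adj-sym G {a} {b} a~b = trans (Graph.sym G b a) a~b

Adj⇒≢ : (G : Graph n) {a b : Fin n} → Adj G a b → a ≢ b
Adj⇒≢ G {a} a~a refl with trans (≡.sym a~a) (irrefl G a)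
... | ()

M-edgeless : (G : Graph n) {S : VSet n} → ¬ HasEdge G S → ∀ x → ¬ M G S x
M-edgeless G noEdge x (x∈S , u , u∈S , x~u) = noEdge (x , u , x∈S , u∈S , x~u)

Iso-empty : (G : Graph n) {A B : VSet n} →
            (∀ x → ¬ A x) → (∀ x → ¬ B x) → Iso G A B
Iso-empty G A-empty B-empty =
  id , id ,
  (λ x x∈A → ⊥-elim (A-empty x x∈A)) ,
  (λ y y∈B → ⊥-elim (B-empty y y∈B)) ,
  (λ _ _ → refl) ,
  (λ _ _ → refl) ,
  (λ _ _ _ _ → refl)

SameEdge : {A : Set} → A → A → A → A → Set
SameEdge a b c d = (a ≡ c × b ≡ d) ⊎ (a ≡ d × b ≡ c)

SameEdge-sym : {A : Set} {a b c d : A} → SameEdge a b c d → SameEdge c d a b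
SameEdge-sym (inj₁ (refl , refl)) = inj₁ (refl , refl)
SameEdge-sym (inj₂ (refl , refl)) = inj₂ (refl , refl)

SameEdge-trans : {A : Set} {a b c d e f : A} →
                 SameEdge a b c d → SameEdge c d e f → SameEdge a b e f
SameEdge-trans (inj₁ (refl , refl)) q                    = q
SameEdge-trans (inj₂ (refl , refl)) (inj₁ (refl , refl)) = inj₂ (refl , refl)
SameEdge-trans (inj₂ (refl , refl)) (inj₂ (refl , refl)) = inj₁ (refl , refl)

edge-through : (G : Graph n) (v : Fin n) → ¬ HasEdge G (Del All v) →
               ∀ {a b} → Adj G a b → ∃[ x ] (Adj G v x × SameEdge a b v x)
edge-through G v noEdge {a} {b} a~b with a ≟ v | b ≟ v
... | yes refl | _        = b , a~b , inj₁ (refl , refl)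
... | no _     | yes refl = a , Adj-sym G a~b , inj₂ (refl , refl)
... | no a≢v   | no b≢v   = ⊥-elim (noEdge (a , b , (tt , a≢v) , (tt , b≢v) , a~b))

two-neighbours : (G : Graph n) (v : Fin n) → ¬ HasEdge G (Del All v) →
                 AtLeastTwoEdges G →
                 ∃[ x ] ∃[ y ] (x ≢ y × Adj G v x × Adj G v y)
two-neighbours G v noEdge (a , b , c , d , a~b , c~d , ab≠cd)
  with edge-through G v noEdge a~b | edge-through G v noEdge c~d
... | x , v~x , ab≡vx | y , v~y , cd≡vy =
  x , y , x≢y , v~x , v~y
  where
  x≢y : x ≢ y
  x≢y refl = ab≠cd (SameEdge-trans ab≡vx (SameEdge-sym cd≡vy))

edgeless-deletion⇒obscure : (G : Graph n) (v : Fin n) {x y : Fin n} →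
                            ¬ HasEdge G (Del All v) →
                            x ≢ y → Adj G v x → Adj G v y → Obscure G v
edgeless-deletion⇒obscure G v {x} {y} noEdge x≢y v~x v~y =
  (tt , x , tt , v~x) , x , y , x≢y ,
  (tt , v , tt , Adj-sym G v~x) ,
  (tt , v , tt , Adj-sym G v~y) ,
  ((tt , λ y≡x → x≢y (≡.sym y≡x)) , v , (tt , Adj⇒≢ G v~x) , Adj-sym G v~y) ,
  ∅ , (λ _ ()) ,
  Iso-empty G (M-edgeless G noEdge) (λ _ ())

fact6p5 : ∀ {n} (H : Graph n) (v : Fin n) →
    AtLeastTwoEdges H → Detectable H v → HasEdge H (Del All v)
fact6p5 H v twoEdges (_ , notObscure) with HasEdge? H (Del? U? v)
... | yes edge  = edge
... | no noEdge with two-neighbours H v noEdge twoEdges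
...   | x , y , x≢y , v~x , v~y =
  ⊥-elim (notObscure (edgeless-deletion⇒obscure H v noEdge x≢y v~x v~y))
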